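{- For every integer $d\ge3$ there exists a $d$-regular bipartite simple graph with an edge $e$ such that $p(e)>1/2$.
   Context: For a finite graph admitting a perfect matching and an edge $e$ of it, $p(e)$ is the probability that $e$ is contained in a uniformly random perfect matching of the graph. -}

module Defs where

open import Data.Nat using (ℕ; zero; suc)
open import Data.Bool using (Bool; true; false; _∧_; not)
open import Data.Fin using (Fin; zero; suc)
open import Data.Fin.Properties using (_≟_)
open import Data.List using (List; []; _∷_; map; concatMap; filterᵇ; length; allFin)
open import Data.Bool.ListAction using (and)
open import Data.Product using (Σ; _×_)
open import Relation.Binary.PropositionalEquality using (_≡_; _≢_)
open import Relation.Nullary.Decidable using (⌊_⌋)

record SimpleGraph (n : ℕ) : Set where
  field
    adj    : Fin n → Fin n → Bool
    symm   : ∀ u v → adj u v ≡ adj v u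
    irrefl : ∀ v → adj v v ≡ false
open SimpleGraph public

degree : ∀ {n} → SimpleGraph n → Fin n → ℕ
degree {n} G v = length (filterᵇ (λ w → adj G v w) (allFin n))

IsRegular : ∀ {n} → ℕ → SimpleGraph n → Set
IsRegular d G = ∀ v → degree G v ≡ d

IsBipartite : ∀ {n} → SimpleGraph n → Set
IsBipartite {n} G = Σ (Fin n → Bool) λ c → ∀ u v → adj G u v ≡ true → c u ≢ c v

-- all functions Fin n → Fin m, each exactly once (up to extensional equality)
allFuns : ∀ n m → List (Fin n → Fin m)
allFuns zero m = (λ ()) ∷ []
allFuns (suc n) m =
  concatMap (λ f → map (λ i → λ { zero → i ; (suc k) → f k }) (allFin m)) (allFuns n m)

-- A perfect matching is encoded as its partner map f : every v is matched to f v,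
-- {v , f v} is an edge and f is an involution (f v ≢ v follows from irreflexivity).
-- Perfect matchings correspond bijectively to such maps.
isPerfectMatching : ∀ {n} → SimpleGraph n → (Fin n → Fin n) → Bool
isPerfectMatching {n} G f = and (map (λ v → adj G v (f v) ∧ ⌊ f (f v) ≟ v ⌋) (allFin n))

perfectMatchings : ∀ {n} → SimpleGraph n → List (Fin n → Fin n)
perfectMatchings {n} G = filterᵇ (isPerfectMatching G) (allFuns n n)

#PM : ∀ {n} → SimpleGraph n → ℕ
#PM G = length (perfectMatchings G)

#PMcontaining : ∀ {n} → SimpleGraph n → Fin n → Fin n → ℕ
#PMcontaining G u v = length (filterᵇ (λ f → ⌊ f u ≟ v ⌋) (perfectMatchings G))

-- p(e) > 1/2 for e = {u , v}, where p(e) = #PMcontaining / #PM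
-- (uniform random perfect matching), i.e. 2 · #PMcontaining > #PM.
-- Note this forces #PM ≥ 1, so p(e) is well defined.
open import Data.Nat using (_*_; _>_)
pGtHalf : ∀ {n} → SimpleGraph n → Fin n → Fin n → Set
pGtHalf G u v = 2 * #PMcontaining G u v > #PM G

module Submission where

-- Let d = k + 1 ≥ 3.  Take an edge U W and, for each of k indices i, a path U – H(false,i) – H(true,i) – W,
-- where every H is a copy of K_{d,d} minus one edge a₀b₀, entered at b₀ and left at a₀; this graph is
-- d-regular and bipartite.  A perfect matching F avoiding U W matches U to b₀ of some H(false,i); as the
-- copy minus b₀ has one more A-vertex than B-vertices, F matches its a₀ outside too, so F runs along
-- path i as U b₀, a₀ b₀', a₀' W.  Choosing one of the k other F-edges inside each of the two copies closes
-- an F-alternating 10-cycle through U W, and flipping it gives a perfect matching containing U W.  The k²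
-- flips of F are distinct and F is recovered from a flip together with i, so
-- k²·#(matchings avoiding U W) ≤ k·#(matchings containing U W), whence p(U W) ≥ k/(k+1) > 1/2.

open import Defs
open import Data.Nat using (ℕ; _≤_)
open import Data.Fin using (Fin)
open import Data.Bool using (true)
open import Data.Product using (Σ; _×_)
open import Relation.Binary.PropositionalEquality using (_≡_)

open import Data.Bool using (Bool; false; T; not; _∧_; if_then_else_)
open import Data.Bool.ListAction using (and)
open import Data.Bool.Properties using (T?; T-∧; T-not-≡; not-¬)
import Data.Bool.Properties as Bool
open import Data.Empty using (⊥; ⊥-elim)
open import Data.Fin using (zero; suc; punchOut)
open import Data.Fin.Permutation.Components using (transpose; transpose-inverse)
import Data.Fin.Properties as Fin
open import Data.List
  using (List; []; _∷_; _++_; _∷ʳ_; map; concatMap; tabulate; length; lookup; filterᵇ; allFin;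
         cartesianProduct; cartesianProductWith)
open import Data.List.Properties using (length-++; length-map; length-tabulate; map-cong)
open import Data.List.Membership.Propositional using (_∈_; _∉_)
import Data.List.Membership.Propositional.Properties as Membershipₚ
import Data.List.Membership.DecPropositional as DecMembership
import Data.List.Membership.Setoid as SetoidMembership
import Data.List.Membership.Setoid.Properties as SetoidMembershipₚ
open import Data.List.Relation.Binary.Permutation.Propositional using (_↭_; ↭-sym)
open import Data.List.Relation.Binary.Permutation.Propositional.Properties using (∈-resp-↭; ∷↭∷ʳ)
open import Data.List.Relation.Unary.All as All using (All; []; _∷_)
import Data.List.Relation.Unary.All.Properties as Allₚ
open import Data.List.Relation.Unary.AllPairs using ([]; _∷_)
open import Data.List.Relation.Unary.Any using (Any; here; there; index)
open import Data.List.Relation.Unary.Unique.Propositional using (Unique)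
import Data.List.Relation.Unary.Unique.Propositional.Properties as Uniqueₚ
open import Data.List.Relation.Unary.Unique.DecPropositional using (unique?)
import Data.List.Relation.Unary.Unique.Setoid as UniqueSetoid
import Data.List.Relation.Unary.Unique.Setoid.Properties as UniqueSetoidₚ
open import Data.Nat using (zero; suc; _+_; _*_; _<_; s≤s; z≤n; >-nonZero)
open import Data.Nat.Properties
  using (+-suc; 1+n≰n; m<m*n; <-≤-trans; <-trans; ≤-antisym; *-cancelʳ-≤; *-assoc; +-monoʳ-<; +-identityʳ;
         module ≤-Reasoning)
open import Data.Product using (_,_; proj₁; proj₂; ∃-syntax)
open import Data.Product.Function.NonDependent.Propositional using (_×-↔_)
open import Data.Product.Relation.Binary.Pointwise.NonDependent using (_×ₛ_)
import Data.Product.Properties as Product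
open import Data.Sum using (_⊎_; inj₁; inj₂)
open import Data.Sum.Function.Propositional using (_⊎-↔_)
import Data.Sum.Properties as Sum
open import Data.Unit using (tt)
open import Function using (id; _∘_; _↔_; mk↔ₛ′; case_of_; Inverse; Equivalence)
open import Function.Construct.Composition using (_↔-∘_)
open import Function.Construct.Identity using (↔-id)
open import Function.Construct.Symmetry using (↔-sym)
open import Level using (0ℓ)
open import Relation.Binary.Bundles using (Setoid)
open import Relation.Binary.Definitions using (DecidableEquality)
open import Relation.Binary.PropositionalEquality
  using (_≢_; _≗_; refl; sym; trans; cong; cong₂; subst; subst₂; setoid; _→-setoid_; module ≡-Reasoning)
open import Relation.Nullary using (does; yes; no; contradiction)
open import Relation.Nullary.Decidable using (⌊_⌋; map′; toWitness; fromWitness)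

-- Lists and counting

module _ {a ℓ} (S : Setoid a ℓ) where
  open Setoid S using (_≈_) renaming (sym to ≈-sym)

  Unique⇒lookup-injective : ∀ {xs} → UniqueSetoid.Unique S xs → ∀ {i j} → lookup xs i ≈ lookup xs j → i ≡ j
  Unique⇒lookup-injective (_ ∷ _)    {zero}  {zero}  _  = refl
  Unique⇒lookup-injective (x≉ ∷ _)   {zero}  {suc j} x≈ = ⊥-elim (All.lookup x≉ (Membershipₚ.∈-lookup j) x≈)
  Unique⇒lookup-injective (x≉ ∷ _)   {suc i} {zero}  x≈ =
    ⊥-elim (All.lookup x≉ (Membershipₚ.∈-lookup i) (≈-sym x≈))
  Unique⇒lookup-injective (_ ∷ uniq) {suc i} {suc j} x≈ = cong suc (Unique⇒lookup-injective uniq x≈)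

module _ {a b ℓ₁ ℓ₂} (S : Setoid a ℓ₁) (T : Setoid b ℓ₂) where
  open Setoid S using () renaming (Carrier to A; _≈_ to _≈₁_)
  open Setoid T using () renaming (Carrier to B; _≈_ to _≈₂_)
  open SetoidMembership T using () renaming (_∈_ to _∈₂_)

  injection⇒length≤ : ∀ {xs : List A} {ys : List B} (φ : A → B) → UniqueSetoid.Unique S xs →
    (∀ {x y} → x ∈ xs → y ∈ xs → φ x ≈₂ φ y → x ≈₁ y) → (∀ {x} → x ∈ xs → φ x ∈₂ ys) →
    length xs ≤ length ys
  injection⇒length≤ {xs} {ys} φ uniq φ-injective φ-into = Fin.injective⇒≤ position-injective
    where
    position : Fin (length xs) → Fin (length ys)
    position i = index (φ-into (Membershipₚ.∈-lookup i))
    position-injective : ∀ {i j} → position i ≡ position j → i ≡ j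
    position-injective {i} {j} eq = Unique⇒lookup-injective S uniq
      (φ-injective (Membershipₚ.∈-lookup i) (Membershipₚ.∈-lookup j)
        (SetoidMembershipₚ.index-injective T (φ-into (Membershipₚ.∈-lookup i)) (φ-into (Membershipₚ.∈-lookup j))
          eq))

Any⇒nonempty : ∀ {a p} {A : Set a} {P : A → Set p} {xs} → Any P xs → 0 < length xs
Any⇒nonempty (here _)  = s≤s z≤n
Any⇒nonempty (there _) = s≤s z≤n

length-cartesianProduct : ∀ {a b} {A : Set a} {B : Set b} (xs : List A) (ys : List B) →
  length (cartesianProduct xs ys) ≡ length xs * length ys
length-cartesianProduct []       ys = refl
length-cartesianProduct (x ∷ xs) ys =
  trans (length-++ (map (x ,_) ys)) (cong₂ _+_ (length-map _ ys) (length-cartesianProduct xs ys))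

length-allFin : ∀ n → length (allFin n) ≡ n
length-allFin n = length-tabulate id

length-filterᵇ-not : ∀ {a} {A : Set a} (p : A → Bool) xs →
  length (filterᵇ p xs) + length (filterᵇ (not ∘ p) xs) ≡ length xs
length-filterᵇ-not p []       = refl
length-filterᵇ-not p (x ∷ xs) with p x
... | true  = cong suc (length-filterᵇ-not p xs)
... | false = trans (+-suc _ _) (cong suc (length-filterᵇ-not p xs))

∈-tabulate⁺ : ∀ {a} {A : Set a} {n} (f : Fin n → A) i → f i ∈ tabulate f
∈-tabulate⁺ f = Membershipₚ.∈-tabulate⁺

∈-tabulate⁻ : ∀ {a} {A : Set a} {n} (f : Fin n → A) {y} → y ∈ tabulate f → ∃[ i ] y ≡ f i
∈-tabulate⁻ f = Membershipₚ.∈-tabulate⁻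

T-and-map⁻ : ∀ {a} {A : Set a} (q : A → Bool) xs → T (and (map q xs)) → All (T ∘ q) xs
T-and-map⁻ q []       _ = []
T-and-map⁻ q (x ∷ xs) t = let qx , t′ = Equivalence.to T-∧ t in qx ∷ T-and-map⁻ q xs t′

T-and-map⁺ : ∀ {a} {A : Set a} (q : A → Bool) xs → All (T ∘ q) xs → T (and (map q xs))
T-and-map⁺ q []       []         = tt
T-and-map⁺ q (x ∷ xs) (qx ∷ qxs) = Equivalence.from T-∧ (qx , T-and-map⁺ q xs qxs)

injective⇒surjective : ∀ {n} {f : Fin n → Fin n} → (∀ {i j} → f i ≡ f j → i ≡ j) →
  ∀ r → ∃[ i ] f i ≡ r
injective⇒surjective {suc n} {f} f-injective r with Fin.any? (λ i → f i Fin.≟ r)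
... | yes hit = hit
... | no miss = contradiction (Fin.injective⇒≤ punchOut-injective) 1+n≰n
  where
  r≢f : ∀ i → r ≢ f i
  r≢f i r≡fi = miss (i , sym r≡fi)
  punchOut-injective : ∀ {i j} → punchOut (r≢f i) ≡ punchOut (r≢f j) → i ≡ j
  punchOut-injective eq = f-injective (Fin.punchOut-injective (r≢f _) (r≢f _) eq)

n*k≤m⇒n<m : ∀ {n k m} → 2 ≤ k → 0 < m → n * k ≤ m → n < m
n*k≤m⇒n<m {zero}      _   0<m _    = 0<m
n*k≤m⇒n<m {suc n} {k} 2≤k _   nk≤m = <-≤-trans (m<m*n (suc n) k 2≤k) nk≤m

-- Perfect matchings of a simple graph on Fin n

_∈≗_ : ∀ {n m} → (Fin n → Fin m) → List (Fin n → Fin m) → Set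
_∈≗_ {n} {m} = SetoidMembership._∈_ (Fin n →-setoid Fin m)

concatMap-map≡cartesianProductWith : ∀ {A B C : Set} (f : A → B → C) xs ys →
  concatMap (λ x → map (f x) ys) xs ≡ cartesianProductWith f xs ys
concatMap-map≡cartesianProductWith f []       ys = refl
concatMap-map≡cartesianProductWith f (x ∷ xs) ys =
  cong (map (f x) ys ++_) (concatMap-map≡cartesianProductWith f xs ys)

allFuns-complete : ∀ n m (f : Fin n → Fin m) → f ∈≗ allFuns n m
allFuns-complete zero    m f = here λ ()
allFuns-complete (suc n) m f =
  subst (f ∈≗_) (sym (concatMap-map≡cartesianProductWith _ (allFuns n m) (allFin m)))
    (SetoidMembershipₚ.∈-resp-≈ (Fin (suc n) →-setoid Fin m) (λ { zero → refl ; (suc x) → refl })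
      (SetoidMembershipₚ.∈-cartesianProductWith⁺ (Fin n →-setoid Fin m) (setoid (Fin m)) (Fin (suc n) →-setoid Fin m)
        (λ g≗g' refl → λ { zero → refl ; (suc x) → g≗g' x })
        (allFuns-complete n m (f ∘ suc)) (Membershipₚ.∈-allFin (f zero))))

allFuns-unique : ∀ n m → UniqueSetoid.Unique (Fin n →-setoid Fin m) (allFuns n m)
allFuns-unique zero    m = All.[] ∷ []
allFuns-unique (suc n) m =
  subst (UniqueSetoid.Unique (Fin (suc n) →-setoid Fin m))
    (sym (concatMap-map≡cartesianProductWith _ (allFuns n m) (allFin m)))
    (UniqueSetoidₚ.cartesianProductWith⁺ (Fin n →-setoid Fin m) (setoid (Fin m)) (Fin (suc n) →-setoid Fin m) _
      (λ e → (λ x → e (suc x)) , e zero) (allFuns-unique n m) (Uniqueₚ.allFin⁺ m))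

module _ {n} (G : SimpleGraph n) where

  isPerfectMatching⁻ : ∀ {f} → T (isPerfectMatching G f) → ∀ p → T (adj G p (f p)) × f (f p) ≡ p
  isPerfectMatching⁻ {f} t p =
    let adjacent , involutive = Equivalence.to T-∧ (All.lookup (T-and-map⁻ _ (allFin n) t) (Membershipₚ.∈-allFin p))
    in adjacent , toWitness involutive

  isPerfectMatching⁺ : ∀ {f} → (∀ p → T (adj G p (f p)) × f (f p) ≡ p) → T (isPerfectMatching G f)
  isPerfectMatching⁺ {f} h = T-and-map⁺ _ (allFin n) (All.tabulate λ {p} _ →
    let adjacent , involutive = h p in Equivalence.from T-∧ (adjacent , fromWitness involutive))

  isPerfectMatching-cong : ∀ {f g} → f ≗ g → isPerfectMatching G f ≡ isPerfectMatching G g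
  isPerfectMatching-cong {f} {g} f≗g = cong and (map-cong (λ p →
    cong₂ _∧_ (cong (adj G p) (f≗g p)) (cong (λ q → ⌊ q Fin.≟ p ⌋) (trans (cong f (f≗g p)) (f≗g (g p)))))
    (allFin n))

  perfectMatchings-unique : UniqueSetoid.Unique (Fin n →-setoid Fin n) (perfectMatchings G)
  perfectMatchings-unique =
    UniqueSetoidₚ.filter⁺ (Fin n →-setoid Fin n) (T? ∘ isPerfectMatching G) (allFuns-unique n n)

  ∈-perfectMatchings⁺ : ∀ {f} → T (isPerfectMatching G f) → f ∈≗ perfectMatchings G
  ∈-perfectMatchings⁺ {f} = SetoidMembershipₚ.∈-filter⁺ (Fin n →-setoid Fin n) (T? ∘ isPerfectMatching G)
    (λ f≗g → subst T (isPerfectMatching-cong f≗g)) (allFuns-complete n n f)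

  ∈-perfectMatchings⁻ : ∀ {f} → f ∈ perfectMatchings G → T (isPerfectMatching G f)
  ∈-perfectMatchings⁻ f∈ = proj₂ (Membershipₚ.∈-filter⁻ (T? ∘ isPerfectMatching G) {xs = allFuns n n} f∈)

-- Perfect matchings of a graph given by neighbour lists

module Matchings {V : Set} (_≟_ : DecidableEquality V) (nb : V → List V)
                 (nb-sym : ∀ {x y} → y ∈ nb x → x ∈ nb y) where

  open DecMembership _≟_ using (_∈?_)

  record IsPerfectMatching (F : V → V) : Set where
    field
      adjacent   : ∀ x → F x ∈ nb x
      involutive : ∀ x → F (F x) ≡ x

    partner : ∀ {x y} → F x ≡ y → F y ≡ x
    partner {x} Fx≡y = trans (cong F (sym Fx≡y)) (involutive x)

    injective : ∀ {x y} → F x ≡ F y → x ≡ y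
    injective {x} {y} eq = trans (sym (partner refl)) (partner (sym eq))

  data Paired (R : V → V → Set) : List V → Set where
    []  : Paired R []
    _∷_ : ∀ {x y zs} → R x y → Paired R zs → Paired R (x ∷ y ∷ zs)

  module _ {R R' : V → V → Set} where

    Paired-zip : ∀ {xs} → Paired R xs → Paired R' xs → Paired (λ x y → R x y × R' x y) xs
    Paired-zip []       []         = []
    Paired-zip (r ∷ rs) (r' ∷ rs') = (r , r') ∷ Paired-zip rs rs'

    Paired-map∈ : ∀ {xs} → (∀ {x y} → x ∈ xs → y ∈ xs → R x y → R' x y) → Paired R xs → Paired R' xs
    Paired-map∈ f []       = []
    Paired-map∈ f (r ∷ rs) =
      f (here refl) (there (here refl)) r ∷ Paired-map∈ (λ x∈ y∈ → f (there (there x∈)) (there (there y∈))) rs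

  Paired-∈ : ∀ {R xs x} → Paired R xs → x ∈ xs → ∃[ y ] y ∈ xs × (R x y ⊎ R y x)
  Paired-∈ (r ∷ rs) (here refl)         = _ , there (here refl) , inj₁ r
  Paired-∈ (r ∷ rs) (there (here refl)) = _ , here refl , inj₂ r
  Paired-∈ (r ∷ rs) (there (there x∈)) with y , y∈ , ry ← Paired-∈ rs x∈ = y , there (there y∈) , ry

  Paired-closed : ∀ {F xs x} → (∀ x → F (F x) ≡ x) → Paired (λ x y → F x ≡ y) xs → x ∈ xs → F x ∈ xs
  Paired-closed {F} {xs} F-involutive pairs x∈ with Paired-∈ pairs x∈
  ... | y , y∈ , inj₁ Fx≡y = subst (_∈ xs) (sym Fx≡y) y∈
  ... | y , y∈ , inj₂ Fy≡x = subst (_∈ xs) (trans (sym (F-involutive y)) (cong F Fy≡x)) y∈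

  rematch : List V → (V → V) → V → V
  rematch (x ∷ y ∷ zs) F v = if does (v ≟ x) then y else if does (v ≟ y) then x else rematch zs F v
  rematch _            F v = F v

  rematch-∉ : ∀ zs F {v} → v ∉ zs → rematch zs F v ≡ F v
  rematch-∉ []           F v∉ = refl
  rematch-∉ (x ∷ [])     F v∉ = refl
  rematch-∉ (x ∷ y ∷ zs) F {v} v∉ with v ≟ x | v ≟ y
  ... | yes v≡x | _       = contradiction (here v≡x) v∉
  ... | no _    | yes v≡y = contradiction (there (here v≡y)) v∉
  ... | no _    | no _    = rematch-∉ zs F (v∉ ∘ there ∘ there)

  Swapped : (V → V) → V → V → Set
  Swapped G x y = G x ≡ y × G y ≡ x

  rematch-swaps : ∀ {R zs} F → Unique zs → Paired R zs → Paired (Swapped (rematch zs F)) zs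
  rematch-swaps F _ [] = []
  rematch-swaps {zs = x ∷ y ∷ zs} F ((x≢y ∷ x≢zs) ∷ y≢zs ∷ uniq) (_ ∷ rs) =
    (at-x , at-y) ∷ Paired-map∈ (λ a∈ b∈ (Ga , Gb) → trans (skip a∈) Ga , trans (skip b∈) Gb)
                                (rematch-swaps F uniq rs)
    where
    at-x : rematch (x ∷ y ∷ zs) F x ≡ y
    at-x with x ≟ x
    ... | yes _  = refl
    ... | no x≢x = contradiction refl x≢x
    at-y : rematch (x ∷ y ∷ zs) F y ≡ x
    at-y with y ≟ x | y ≟ y
    ... | yes y≡x | _      = contradiction (sym y≡x) x≢y
    ... | no _    | yes _  = refl
    ... | no _    | no y≢y = contradiction refl y≢y
    skip : ∀ {v} → v ∈ zs → rematch (x ∷ y ∷ zs) F v ≡ rematch zs F v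
    skip {v} v∈ with v ≟ x | v ≟ y
    ... | yes refl | _        = contradiction refl (All.lookup x≢zs v∈)
    ... | no _     | yes refl = contradiction refl (All.lookup y≢zs v∈)
    ... | no _     | no _     = refl

  -- cyc and cyc' list the same F-alternating cycle, cyc starting with an F-edge and cyc' with a non-F-edge.
  module _ {F : V → V} (pm : IsPerfectMatching F) {cyc cyc' : List V} (cyc↭cyc' : cyc ↭ cyc')
           (F-pairs : Paired (λ x y → F x ≡ y) cyc) where
    open IsPerfectMatching pm

    ∉-closed : ∀ {x} → x ∉ cyc' → F x ∉ cyc'
    ∉-closed {x} x∉ Fx∈ = x∉ (∈-resp-↭ cyc↭cyc'
      (subst (_∈ cyc) (involutive x) (Paired-closed involutive F-pairs (∈-resp-↭ (↭-sym cyc↭cyc') Fx∈))))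

    rematch-isPerfectMatching : Unique cyc' → Paired (λ x y → y ∈ nb x) cyc' → IsPerfectMatching (rematch cyc' F)
    rematch-isPerfectMatching uniq edges = record
      { adjacent = λ x → proj₁ (matched x) ; involutive = λ x → proj₂ (matched x) }
      where
      G = rematch cyc' F
      matched : ∀ x → G x ∈ nb x × G (G x) ≡ x
      matched x with x ∈? cyc'
      ... | no x∉ = subst (_∈ nb x) (sym (rematch-∉ cyc' F x∉)) (adjacent x) ,
        trans (cong G (rematch-∉ cyc' F x∉)) (trans (rematch-∉ cyc' F (∉-closed x∉)) (involutive x))
      ... | yes x∈ with Paired-∈ (Paired-zip (rematch-swaps F uniq edges) edges) x∈
      ...   | y , _ , inj₁ ((Gx≡y , Gy≡x) , y∈nbx) =
        subst (_∈ nb x) (sym Gx≡y) y∈nbx , trans (cong G Gx≡y) Gy≡x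
      ...   | y , _ , inj₂ ((Gy≡x , Gx≡y) , x∈nby) =
        subst (_∈ nb x) (sym Gx≡y) (nb-sym x∈nby) , trans (cong G Gx≡y) Gy≡x

    rematch-injective : ∀ {F'} → IsPerfectMatching F' → Paired (λ x y → F' x ≡ y) cyc →
      rematch cyc' F ≗ rematch cyc' F' → F ≗ F'
    rematch-injective {F'} pm' F'-pairs G≗G' x with x ∈? cyc
    ... | no x∉ = trans (sym (rematch-∉ cyc' F x∉')) (trans (G≗G' x) (rematch-∉ cyc' F' x∉'))
      where x∉' = λ x∈ → x∉ (∈-resp-↭ (↭-sym cyc↭cyc') x∈)
    ... | yes x∈ with Paired-∈ (Paired-zip F-pairs F'-pairs) x∈
    ...   | y , _ , inj₁ (Fx≡y , F'x≡y) = trans Fx≡y (sym F'x≡y)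
    ...   | y , _ , inj₂ (Fy≡x , F'y≡x) =
      trans (cong F (sym Fy≡x)) (trans (involutive y) (sym (IsPerfectMatching.partner pm' F'y≡x)))

module NeighbourGraph {V : Set} (_≟_ : DecidableEquality V) {n} (ι : V ↔ Fin n) (nb : V → List V)
  (nb-sym : ∀ {x y} → y ∈ nb x → x ∈ nb y) (nb-irrefl : ∀ {x} → x ∉ nb x) where

  open Inverse ι public using (to; from; strictlyInverseˡ; strictlyInverseʳ)
  open DecMembership _≟_ using (_∈?_)
  open Matchings _≟_ nb nb-sym public

  to-injective : ∀ {x y} → to x ≡ to y → x ≡ y
  to-injective {x} {y} eq = trans (sym (strictlyInverseʳ x)) (trans (cong from eq) (strictlyInverseʳ y))

  from-injective : ∀ {p q} → from p ≡ from q → p ≡ q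
  from-injective {p} {q} eq = trans (sym (strictlyInverseˡ p)) (trans (cong to eq) (strictlyInverseˡ q))

  isNeighbour : V → V → Bool
  isNeighbour x y = ⌊ y ∈? nb x ⌋

  isNeighbour⁻ : ∀ {x y} → T (isNeighbour x y) → y ∈ nb x
  isNeighbour⁻ {x} {y} = toWitness {a? = y ∈? nb x}

  isNeighbour⁺ : ∀ {x y} → y ∈ nb x → isNeighbour x y ≡ true
  isNeighbour⁺ {x} {y} y∈ with y ∈? nb x
  ... | yes _  = refl
  ... | no y∉ = contradiction y∈ y∉

  isNeighbour-sym : ∀ x y → isNeighbour x y ≡ isNeighbour y x
  isNeighbour-sym x y with y ∈? nb x | x ∈? nb y
  ... | yes _  | yes _  = refl
  ... | no _   | no _   = refl
  ... | yes y∈ | no x∉  = contradiction (nb-sym y∈) x∉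
  ... | no y∉  | yes x∈ = contradiction (nb-sym x∈) y∉

  isNeighbour-irrefl : ∀ x → isNeighbour x x ≡ false
  isNeighbour-irrefl x with x ∈? nb x
  ... | yes x∈ = contradiction x∈ nb-irrefl
  ... | no _   = refl

  graph : SimpleGraph n
  graph = record
    { adj    = λ p q → isNeighbour (from p) (from q)
    ; symm   = λ p q → isNeighbour-sym (from p) (from q)
    ; irrefl = λ p → isNeighbour-irrefl (from p)
    }

  graph-adj : ∀ {x y} → y ∈ nb x → adj graph (to x) (to y) ≡ true
  graph-adj {x} {y} y∈ = trans (cong₂ isNeighbour (strictlyInverseʳ x) (strictlyInverseʳ y)) (isNeighbour⁺ y∈)

  degree-graph : (∀ x → Unique (nb x)) → ∀ p → degree graph p ≡ length (nb (from p))
  degree-graph nb-unique p = ≤-antisym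
    (injection⇒length≤ (setoid (Fin n)) (setoid V) from graph-nb-unique (λ _ _ → from-injective) from-graph-nb)
    (injection⇒length≤ (setoid V) (setoid (Fin n)) to (nb-unique x) (λ _ _ → to-injective) to-graph-nb)
    where
    x = from p
    graph-nb = filterᵇ (isNeighbour x ∘ from) (allFin n)
    graph-nb-unique : Unique graph-nb
    graph-nb-unique = Uniqueₚ.filter⁺ (T? ∘ isNeighbour x ∘ from) (Uniqueₚ.allFin⁺ n)
    from-graph-nb : ∀ {q} → q ∈ graph-nb → from q ∈ nb x
    from-graph-nb q∈ =
      isNeighbour⁻ (proj₂ (Membershipₚ.∈-filter⁻ (T? ∘ isNeighbour x ∘ from) {xs = allFin n} q∈))
    to-graph-nb : ∀ {y} → y ∈ nb x → to y ∈ graph-nb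
    to-graph-nb {y} y∈ = Membershipₚ.∈-filter⁺ (T? ∘ isNeighbour x ∘ from) (Membershipₚ.∈-allFin (to y))
      (subst T (sym (trans (cong (isNeighbour x) (strictlyInverseʳ y)) (isNeighbour⁺ y∈))) tt)

  graph-bipartite : (side : V → Bool) → (∀ {x y} → y ∈ nb x → side x ≢ side y) → IsBipartite graph
  graph-bipartite side nb-side = side ∘ from , λ p q pq → nb-side (isNeighbour⁻ (subst T (sym pq) tt))

  onVertices : (Fin n → Fin n) → V → V
  onVertices f = from ∘ f ∘ to

  onFin : (V → V) → Fin n → Fin n
  onFin F = to ∘ F ∘ from

  onVertices-isPerfectMatching : ∀ {f} → T (isPerfectMatching graph f) → IsPerfectMatching (onVertices f)
  onVertices-isPerfectMatching {f} t = record
    { adjacent   = λ x → isNeighbour⁻ (subst (λ y → T (isNeighbour y (onVertices f x))) (strictlyInverseʳ x)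
                                      (proj₁ (isPerfectMatching⁻ graph t (to x))))
    ; involutive = λ x → begin
        from (f (to (from (f (to x))))) ≡⟨ cong (from ∘ f) (strictlyInverseˡ (f (to x))) ⟩
        from (f (f (to x)))             ≡⟨ cong from (proj₂ (isPerfectMatching⁻ graph t (to x))) ⟩
        from (to x)                     ≡⟨ strictlyInverseʳ x ⟩
        x                               ∎
    }
    where open ≡-Reasoning

  onFin-isPerfectMatching : ∀ {F} → IsPerfectMatching F → T (isPerfectMatching graph (onFin F))
  onFin-isPerfectMatching {F} pm = isPerfectMatching⁺ graph λ p →
    subst T (sym (trans (cong (isNeighbour (from p)) (strictlyInverseʳ (F (from p))))
                        (isNeighbour⁺ (adjacent (from p))))) tt ,
    (begin
      to (F (from (to (F (from p))))) ≡⟨ cong (to ∘ F) (strictlyInverseʳ (F (from p))) ⟩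
      to (F (F (from p)))             ≡⟨ cong to (involutive (from p)) ⟩
      to (from p)                     ≡⟨ strictlyInverseˡ p ⟩
      p                               ∎)
    where
    open ≡-Reasoning
    open IsPerfectMatching pm

  onFin-injective : ∀ {F F'} → onFin F ≗ onFin F' → F ≗ F'
  onFin-injective {F} {F'} eq x = to-injective (subst (λ y → to (F y) ≡ to (F' y)) (strictlyInverseʳ x) (eq (to x)))

  onVertices-injective : ∀ {f f'} → onVertices f ≗ onVertices f' → f ≗ f'
  onVertices-injective {f} {f'} eq p = subst (λ q → f q ≡ f' q) (strictlyInverseˡ p) (from-injective (eq (from p)))

-- A c i x and B c i x (x : Fin (suc k)) are the two sides of the copy H(c,i) of K_{k+1,k+1} minus the
-- edge A c i 0 – B c i 0; path i is U – B false i 0, A false i 0 – B true i 0, A true i 0 – W.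
module Gadget (k : ℕ) where

  data Vertex : Set where
    U W : Vertex
    A B : Bool → Fin k → Fin (suc k) → Vertex

  Code : Set
  Code = Fin 2 ⊎ (Fin k × (Bool × (Bool × Fin (suc k))))

  encode : Vertex → Code
  encode U         = inj₁ zero
  encode W         = inj₁ (suc zero)
  encode (A c i x) = inj₂ (i , true , c , x)
  encode (B c i x) = inj₂ (i , false , c , x)

  decode : Code → Vertex
  decode (inj₁ zero)                = U
  decode (inj₁ (suc zero))          = W
  decode (inj₂ (i , true , c , x))  = A c i x
  decode (inj₂ (i , false , c , x)) = B c i x

  encode-decode : ∀ c → encode (decode c) ≡ c
  encode-decode (inj₁ zero)                = refl
  encode-decode (inj₁ (suc zero))          = refl
  encode-decode (inj₂ (i , true , c , x))  = refl
  encode-decode (inj₂ (i , false , c , x)) = refl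

  decode-encode : ∀ v → decode (encode v) ≡ v
  decode-encode U         = refl
  decode-encode W         = refl
  decode-encode (A c i x) = refl
  decode-encode (B c i x) = refl

  encode-injective : ∀ {v w} → encode v ≡ encode w → v ≡ w
  encode-injective {v} {w} eq = trans (sym (decode-encode v)) (trans (cong decode eq) (decode-encode w))

  _≟_ : DecidableEquality Vertex
  v ≟ w = map′ encode-injective (cong encode) (encode v ≟ᶜ encode w)
    where
    _≟ᶜ_ : DecidableEquality Code
    _≟ᶜ_ = Sum.≡-dec Fin._≟_ (Product.≡-dec Fin._≟_ (Product.≡-dec Bool._≟_ (Product.≡-dec Bool._≟_ Fin._≟_)))

  N : ℕ
  N = 2 + k * (2 * (2 * suc k))

  vertex↔fin : Vertex ↔ Fin N
  vertex↔fin = ↔-sym fin↔code ↔-∘ mk↔ₛ′ encode decode encode-decode decode-encode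
    where
    fin↔code : Fin N ↔ Code
    fin↔code =
      (↔-id _ ⊎-↔ ((↔-id _ ×-↔ ((Fin.2↔Bool ×-↔ ((Fin.2↔Bool ×-↔ ↔-id _) ↔-∘ Fin.*↔×)) ↔-∘ Fin.*↔×))
                   ↔-∘ Fin.*↔×))
      ↔-∘ Fin.+↔⊎

  exitA exitB : Bool → Fin k → Vertex
  exitA true  i = W
  exitA false i = B true i zero
  exitB true  i = A false i zero
  exitB false i = U

  neighbours : Vertex → List Vertex
  neighbours U               = W ∷ tabulate (λ i → B false i zero)
  neighbours W               = U ∷ tabulate (λ i → A true i zero)
  neighbours (A c i zero)    = exitA c i ∷ tabulate (B c i ∘ suc)
  neighbours (A c i (suc _)) = tabulate (B c i)
  neighbours (B c i zero)    = exitB c i ∷ tabulate (A c i ∘ suc)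
  neighbours (B c i (suc _)) = tabulate (A c i)

  neighbours-sym : ∀ {x y} → y ∈ neighbours x → x ∈ neighbours y
  neighbours-sym {U}              (here refl) = here refl
  neighbours-sym {U}              (there y∈) with i , refl ← ∈-tabulate⁻ _ y∈ = here refl
  neighbours-sym {W}              (here refl) = here refl
  neighbours-sym {W}              (there y∈) with i , refl ← ∈-tabulate⁻ _ y∈ = here refl
  neighbours-sym {A true i zero}  (here refl) = there (∈-tabulate⁺ _ i)
  neighbours-sym {A false i zero} (here refl) = here refl
  neighbours-sym {A c i zero}     (there y∈) with r , refl ← ∈-tabulate⁻ (B c i ∘ suc) y∈ =
    ∈-tabulate⁺ (A c i) zero
  neighbours-sym {A c i (suc r)}  y∈ with ∈-tabulate⁻ (B c i) y∈
  ... | zero  , refl = there (∈-tabulate⁺ (A c i ∘ suc) r)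
  ... | suc _ , refl = ∈-tabulate⁺ (A c i) (suc r)
  neighbours-sym {B true i zero}  (here refl) = here refl
  neighbours-sym {B false i zero} (here refl) = there (∈-tabulate⁺ _ i)
  neighbours-sym {B c i zero}     (there y∈) with r , refl ← ∈-tabulate⁻ (A c i ∘ suc) y∈ =
    ∈-tabulate⁺ (B c i) zero
  neighbours-sym {B c i (suc r)}  y∈ with ∈-tabulate⁻ (A c i) y∈
  ... | zero  , refl = there (∈-tabulate⁺ (B c i ∘ suc) r)
  ... | suc _ , refl = ∈-tabulate⁺ (B c i) (suc r)

  side : Vertex → Bool
  side U         = true
  side W         = false
  side (A _ _ _) = true
  side (B _ _ _) = false

  neighbours-side : ∀ x → All (λ y → side y ≡ not (side x)) (neighbours x)
  neighbours-side U                = refl ∷ Allₚ.tabulate⁺ λ _ → refl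
  neighbours-side W                = refl ∷ Allₚ.tabulate⁺ λ _ → refl
  neighbours-side (A true i zero)  = refl ∷ Allₚ.tabulate⁺ λ _ → refl
  neighbours-side (A false i zero) = refl ∷ Allₚ.tabulate⁺ λ _ → refl
  neighbours-side (A c i (suc _))  = Allₚ.tabulate⁺ {f = B c i} λ _ → refl
  neighbours-side (B true i zero)  = refl ∷ Allₚ.tabulate⁺ λ _ → refl
  neighbours-side (B false i zero) = refl ∷ Allₚ.tabulate⁺ λ _ → refl
  neighbours-side (B c i (suc _))  = Allₚ.tabulate⁺ {f = A c i} λ _ → refl

  neighbours-bipartite : ∀ {x y} → y ∈ neighbours x → side x ≢ side y
  neighbours-bipartite {x} y∈ side≡ = not-¬ refl (trans side≡ (All.lookup (neighbours-side x) y∈))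

  neighbours-irrefl : ∀ {x} → x ∉ neighbours x
  neighbours-irrefl x∈ = neighbours-bipartite x∈ refl

  neighbours-unique : ∀ x → Unique (neighbours x)
  neighbours-unique U                = Allₚ.tabulate⁺ (λ _ ()) ∷ Uniqueₚ.tabulate⁺ λ { refl → refl }
  neighbours-unique W                = Allₚ.tabulate⁺ (λ _ ()) ∷ Uniqueₚ.tabulate⁺ λ { refl → refl }
  neighbours-unique (A true i zero)  = Allₚ.tabulate⁺ (λ _ ()) ∷ Uniqueₚ.tabulate⁺ λ { refl → refl }
  neighbours-unique (A false i zero) = Allₚ.tabulate⁺ (λ _ ()) ∷ Uniqueₚ.tabulate⁺ λ { refl → refl }
  neighbours-unique (A c i (suc _))  = Uniqueₚ.tabulate⁺ {f = B c i} λ { refl → refl }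
  neighbours-unique (B true i zero)  = Allₚ.tabulate⁺ (λ _ ()) ∷ Uniqueₚ.tabulate⁺ λ { refl → refl }
  neighbours-unique (B false i zero) = Allₚ.tabulate⁺ (λ _ ()) ∷ Uniqueₚ.tabulate⁺ λ { refl → refl }
  neighbours-unique (B c i (suc _))  = Uniqueₚ.tabulate⁺ {f = A c i} λ { refl → refl }

  length-neighbours : ∀ x → length (neighbours x) ≡ suc k
  length-neighbours U               = cong suc (length-tabulate _)
  length-neighbours W               = cong suc (length-tabulate _)
  length-neighbours (A c i zero)    = cong suc (length-tabulate _)
  length-neighbours (A c i (suc _)) = length-tabulate (B c i)
  length-neighbours (B c i zero)    = cong suc (length-tabulate _)
  length-neighbours (B c i (suc _)) = length-tabulate (A c i)

  open NeighbourGraph _≟_ vertex↔fin neighbours neighbours-sym neighbours-irrefl public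

  graph-regular : IsRegular (suc k) graph
  graph-regular p = trans (degree-graph neighbours-unique p) (length-neighbours (from p))

  module Block {F} (pm : IsPerfectMatching F) (c : Bool) (i : Fin k)
               (B₀-exits : ∀ x → F (B c i zero) ≢ A c i x) where
    open IsPerfectMatching pm

    slot : Fin k → Fin (suc k)
    slot t = proj₁ (∈-tabulate⁻ (B c i) (adjacent (A c i (suc t))))

    F-A-suc : ∀ t → F (A c i (suc t)) ≡ B c i (slot t)
    F-A-suc t = proj₂ (∈-tabulate⁻ (B c i) (adjacent (A c i (suc t))))

    zero≢slot : ∀ t → zero ≢ slot t
    zero≢slot t z≡ = B₀-exits (suc t) (partner (trans (F-A-suc t) (cong (B c i) (sym z≡))))

    slot-injective : ∀ {t t'} → slot t ≡ slot t' → t ≡ t'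
    slot-injective {t} {t'} eq with refl ← injective (trans (F-A-suc t) (trans (cong (B c i) eq) (sym (F-A-suc t')))) =
      refl

    F-A-suc≡B-suc : ∀ t → ∃[ y ] F (A c i (suc t)) ≡ B c i (suc y)
    F-A-suc≡B-suc t = punchOut (zero≢slot t) , trans (F-A-suc t) (cong (B c i) (sym (Fin.punchIn-punchOut (zero≢slot t))))

    -- The k vertices A c i (suc t) already take all k slots B c i (suc y), leaving none for A c i 0.
    A₀-exits : F (A c i zero) ≡ exitA c i
    A₀-exits with adjacent (A c i zero)
    ... | here F-A₀ = F-A₀
    ... | there F-A₀∈ with r₀ , F-A₀ ← ∈-tabulate⁻ (B c i ∘ suc) F-A₀∈
          with t , eq ← injective⇒surjective
                           (λ eq → slot-injective (Fin.punchOut-injective (zero≢slot _) (zero≢slot _) eq)) r₀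
          = contradiction (injective (trans (proj₂ (F-A-suc≡B-suc t)) (trans (cong (B c i ∘ suc) eq) (sym F-A₀)))) λ ()

  avoiding-UW : ∀ {F} → IsPerfectMatching F → F U ≢ W → ∃[ i ] F U ≡ B false i zero
  avoiding-UW pm F-U≢W with IsPerfectMatching.adjacent pm U
  ... | here F-U   = contradiction F-U F-U≢W
  ... | there F-U∈ = ∈-tabulate⁻ _ F-U∈

  -- For F matching U into block i, U ∷ pathOf F i r s is an F-alternating 10-cycle with F-edges in even
  -- positions; switch flips it.
  path : Fin k → Fin k → Fin k → Vertex → Vertex → List Vertex
  path i r s b b' = B false i zero ∷ A false i (suc s) ∷ b ∷ A false i zero ∷
                    B true i zero ∷ A true i (suc r) ∷ b' ∷ A true i zero ∷ W ∷ []

  pathOf : (Vertex → Vertex) → Fin k → Fin k → Fin k → List Vertex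
  pathOf F i r s = path i r s (F (A false i (suc s))) (F (A true i (suc r)))

  switch : (Vertex → Vertex) → Fin k → Fin k → Fin k → Vertex → Vertex
  switch F i r s = rematch (pathOf F i r s ∷ʳ U) F

  -- The ten vertices on a path have distinct kinds, so its uniqueness is decided by computation.
  Kind : Set
  Kind = Bool ⊎ (Bool × Bool × Bool)

  kind : Vertex → Kind
  kind U               = inj₁ true
  kind W               = inj₁ false
  kind (A c _ zero)    = inj₂ (true , c , true)
  kind (A c _ (suc _)) = inj₂ (true , c , false)
  kind (B c _ zero)    = inj₂ (false , c , true)
  kind (B c _ (suc _)) = inj₂ (false , c , false)

  _≟ᴷ_ : DecidableEquality Kind
  _≟ᴷ_ = Sum.≡-dec Bool._≟_ (Product.≡-dec Bool._≟_ (Product.≡-dec Bool._≟_ Bool._≟_))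

  path∷ʳU-unique : ∀ i r s y y' → Unique (path i r s (B false i (suc y)) (B true i (suc y')) ∷ʳ U)
  path∷ʳU-unique i r s y y' = Uniqueₚ.map⁻ {f = kind}
    (toWitness {a? = unique? _≟ᴷ_ (map kind (path i r s (B false i (suc y)) (B true i (suc y')) ∷ʳ U))} tt)

  module MatchedIntoBlock {F} (pm : IsPerfectMatching F) {i} (F-U : F U ≡ B false i zero) where
    open IsPerfectMatching pm

    private
      module First = Block pm false i (λ x F-B₀≡ → case trans (sym (partner F-U)) F-B₀≡ of λ ())

    F-A-false : F (A false i zero) ≡ B true i zero
    F-A-false = First.A₀-exits

    private
      module Second = Block pm true i (λ x F-B₀≡ → case trans (sym (partner F-A-false)) F-B₀≡ of λ ())

    F-A-true : F (A true i zero) ≡ W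
    F-A-true = Second.A₀-exits

    cycle-F-pairs : ∀ r s → Paired (λ x y → F x ≡ y) (U ∷ pathOf F i r s)
    cycle-F-pairs r s = F-U ∷ refl ∷ F-A-false ∷ refl ∷ F-A-true ∷ []

    module _ (r s : Fin k) where

      flipped-edges : Paired (λ x y → y ∈ neighbours x) (pathOf F i r s ∷ʳ U)
      flipped-edges with y , F-a ← First.F-A-suc≡B-suc s | y' , F-a' ← Second.F-A-suc≡B-suc r rewrite F-a | F-a' =
        there (∈-tabulate⁺ _ s) ∷ ∈-tabulate⁺ (A false i) zero ∷
        there (∈-tabulate⁺ _ r) ∷ ∈-tabulate⁺ (A true i) zero ∷ here refl ∷ []

      flipped-unique : Unique (pathOf F i r s ∷ʳ U)
      flipped-unique with y , F-a ← First.F-A-suc≡B-suc s | y' , F-a' ← Second.F-A-suc≡B-suc r rewrite F-a | F-a' =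
        path∷ʳU-unique i r s y y'

      switch-isPerfectMatching : IsPerfectMatching (switch F i r s)
      switch-isPerfectMatching =
        rematch-isPerfectMatching pm (∷↭∷ʳ U (pathOf F i r s)) (cycle-F-pairs r s) flipped-unique flipped-edges

      switch-swaps : Paired (Swapped (switch F i r s)) (pathOf F i r s ∷ʳ U)
      switch-swaps = rematch-swaps F flipped-unique flipped-edges

      switch-U : switch F i r s U ≡ W
      switch-U with _ ∷ _ ∷ _ ∷ _ ∷ (_ , G-U) ∷ [] ← switch-swaps = G-U

      switch-B-false : switch F i r s (B false i zero) ≡ A false i (suc s)
      switch-B-false with (G-B , _) ∷ _ ← switch-swaps = G-B

      switch-A-false : switch F i r s (A false i zero) ≡ F (A false i (suc s))
      switch-A-false with _ ∷ (_ , G-A) ∷ _ ← switch-swaps = G-A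

      switch-B-true : switch F i r s (B true i zero) ≡ A true i (suc r)
      switch-B-true with _ ∷ _ ∷ (G-B , _) ∷ _ ← switch-swaps = G-B

      switch-A-true : switch F i r s (A true i zero) ≡ F (A true i (suc r))
      switch-A-true with _ ∷ _ ∷ _ ∷ (_ , G-A) ∷ _ ← switch-swaps = G-A

  switch-injective : ∀ {F F' i r s r' s'} → IsPerfectMatching F → IsPerfectMatching F' →
    F U ≡ B false i zero → F' U ≡ B false i zero →
    switch F i r s ≗ switch F' i r' s' → F ≗ F' × r ≡ r' × s ≡ s'
  switch-injective {F} {F'} {i} {r} {s} {r'} {s'} pm pm' F-U F'-U G≗G'
    with refl ← trans (sym (MatchedIntoBlock.switch-B-true pm F-U r s))
                  (trans (G≗G' (B true i zero)) (MatchedIntoBlock.switch-B-true pm' F'-U r' s'))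
       | refl ← trans (sym (MatchedIntoBlock.switch-B-false pm F-U r s))
                  (trans (G≗G' (B false i zero)) (MatchedIntoBlock.switch-B-false pm' F'-U r' s'))
    = rematch-injective pm (∷↭∷ʳ U (pathOf F i r s)) (M.cycle-F-pairs r s) pm'
        (subst (λ p → Paired (λ x y → F' x ≡ y) (U ∷ p)) (sym same-path) (M'.cycle-F-pairs r s))
        (λ x → trans (G≗G' x) (cong (λ p → rematch (p ∷ʳ U) F' x) (sym same-path)))
      , refl , refl
    where
    module M = MatchedIntoBlock pm F-U
    module M' = MatchedIntoBlock pm' F'-U
    same-path : pathOf F i r s ≡ pathOf F' i r s
    same-path = cong₂ (path i r s)
      (trans (sym (M.switch-A-false r s)) (trans (G≗G' (A false i zero)) (M'.switch-A-false r s)))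
      (trans (sym (M.switch-A-true r s)) (trans (G≗G' (A true i zero)) (M'.switch-A-true r s)))

  matchUW : Vertex → Vertex
  matchUW U         = W
  matchUW W         = U
  matchUW (A c i x) = B c i (transpose zero (suc i) x)
  matchUW (B c i x) = A c i (transpose (suc i) zero x)

  matchUW-isPerfectMatching : IsPerfectMatching matchUW
  matchUW-isPerfectMatching = record { adjacent = adjacent ; involutive = involutive }
    where
    adjacent : ∀ x → matchUW x ∈ neighbours x
    adjacent U               = here refl
    adjacent W               = here refl
    adjacent (A c i zero)    = there (∈-tabulate⁺ _ i)
    adjacent (A c i (suc t)) = ∈-tabulate⁺ (B c i) _
    adjacent (B c i zero)    = there (∈-tabulate⁺ _ i)
    adjacent (B c i (suc t)) = ∈-tabulate⁺ (A c i) _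
    involutive : ∀ x → matchUW (matchUW x) ≡ x
    involutive U         = refl
    involutive W         = refl
    involutive (A c i x) = cong (A c i) (transpose-inverse (suc i) zero)
    involutive (B c i x) = cong (B c i) (transpose-inverse zero (suc i))

  u₀ v₀ : Fin N
  u₀ = to U
  v₀ = to W

  containsUW : (Fin N → Fin N) → Bool
  containsUW f = ⌊ f u₀ Fin.≟ v₀ ⌋

  containing avoiding : List (Fin N → Fin N)
  containing = filterᵇ containsUW (perfectMatchings graph)
  avoiding   = filterᵇ (not ∘ containsUW) (perfectMatchings graph)

  onFin-∈-containing : ∀ {G} → IsPerfectMatching G → G U ≡ W → onFin G ∈≗ containing
  onFin-∈-containing {G} pm G-U = SetoidMembershipₚ.∈-filter⁺ (Fin N →-setoid Fin N) (T? ∘ containsUW)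
    (λ f≗g t → fromWitness (trans (sym (f≗g u₀)) (toWitness t)))
    (∈-perfectMatchings⁺ graph (onFin-isPerfectMatching pm))
    (fromWitness (cong to (trans (cong G (strictlyInverseʳ U)) G-U)))

  ∈-avoiding⁻ : ∀ {f} → f ∈ avoiding →
    IsPerfectMatching (onVertices f) × ∃[ i ] onVertices f U ≡ B false i zero
  ∈-avoiding⁻ {f} f∈ = pm , avoiding-UW pm λ F-U≡W →
      not-containing (fromWitness {a? = f u₀ Fin.≟ v₀} (trans (sym (strictlyInverseˡ (f u₀))) (cong to F-U≡W)))
    where
    f∈PMs×avoids : f ∈ perfectMatchings graph × T (not (containsUW f))
    f∈PMs×avoids = Membershipₚ.∈-filter⁻ (T? ∘ not ∘ containsUW) {xs = perfectMatchings graph} f∈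
    pm : IsPerfectMatching (onVertices f)
    pm = onVertices-isPerfectMatching {f} (∈-perfectMatchings⁻ graph {f} (proj₁ f∈PMs×avoids))
    not-containing : T (containsUW f) → ⊥
    not-containing = subst T (Equivalence.to T-not-≡ (proj₂ f∈PMs×avoids))

  -- The default is a junk value for U and W; below blockOr is only applied to F U = B false i 0.
  blockOr : Fin k → Vertex → Fin k
  blockOr _ (A _ i _) = i
  blockOr _ (B _ i _) = i
  blockOr j _         = j

  switchWithBlock : (Fin N → Fin N) × (Fin k × Fin k) → (Fin N → Fin N) × Fin k
  switchWithBlock (f , r , s) = onFin (switch F i r s) , i
    where
    F = onVertices f
    i = blockOr r (F U)

  Triples Pairs : Setoid 0ℓ 0ℓ
  Triples = (Fin N →-setoid Fin N) ×ₛ (setoid (Fin k) ×ₛ setoid (Fin k))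
  Pairs   = (Fin N →-setoid Fin N) ×ₛ setoid (Fin k)

  triples : List ((Fin N → Fin N) × (Fin k × Fin k))
  triples = cartesianProduct avoiding (cartesianProduct (allFin k) (allFin k))

  ∈-triples⁻ : ∀ {f r s} → (f , r , s) ∈ triples →
    IsPerfectMatching (onVertices f) × onVertices f U ≡ B false (blockOr r (onVertices f U)) zero
  ∈-triples⁻ {f} {r} x∈ =
    let pm , i , F-U = ∈-avoiding⁻
          (proj₁ (Membershipₚ.∈-cartesianProduct⁻ avoiding (cartesianProduct (allFin k) (allFin k)) x∈))
    in pm , trans F-U (cong (λ v → B false (blockOr r v) zero) (sym F-U))

  triples-unique : UniqueSetoid.Unique Triples triples
  triples-unique = UniqueSetoidₚ.cartesianProduct⁺ (Fin N →-setoid Fin N) (setoid (Fin k) ×ₛ setoid (Fin k))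
    (UniqueSetoidₚ.filter⁺ (Fin N →-setoid Fin N) (T? ∘ not ∘ containsUW) (perfectMatchings-unique graph))
    (UniqueSetoidₚ.cartesianProduct⁺ (setoid (Fin k)) (setoid (Fin k)) (Uniqueₚ.allFin⁺ k) (Uniqueₚ.allFin⁺ k))

  switchWithBlock-injective : ∀ {x y} → x ∈ triples → y ∈ triples →
    Setoid._≈_ Pairs (switchWithBlock x) (switchWithBlock y) → Setoid._≈_ Triples x y
  switchWithBlock-injective {f , r , s} {f' , r' , s'} x∈ y∈ (G≗G' , i≡i') =
    let F = onVertices f
        F' = onVertices f'
        i = blockOr r (F U)
        pm , F-U = ∈-triples⁻ x∈
        pm' , F'-U = ∈-triples⁻ y∈
        F≗F' , r≡r' , s≡s' = switch-injective {F} {F'} {i} {r} {s} {r'} {s'} pm pm' F-U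
          (subst (λ j → F' U ≡ B false j zero) (sym i≡i') F'-U)
          (subst (λ j → switch F i r s ≗ switch F' j r' s') (sym i≡i')
            (onFin-injective {switch F i r s} {switch F' (blockOr r' (F' U)) r' s'} G≗G'))
    in onVertices-injective {f} {f'} F≗F' , r≡r' , s≡s'

  switchWithBlock-∈ : ∀ {x} → x ∈ triples →
    SetoidMembership._∈_ Pairs (switchWithBlock x) (cartesianProduct containing (allFin k))
  switchWithBlock-∈ {f , r , s} x∈ =
    let pm , F-U = ∈-triples⁻ x∈
        i = blockOr r (onVertices f U)
    in SetoidMembershipₚ.∈-cartesianProduct⁺ (Fin N →-setoid Fin N) (setoid (Fin k))
         (onFin-∈-containing {switch (onVertices f) i r s}
           (MatchedIntoBlock.switch-isPerfectMatching pm F-U r s) (MatchedIntoBlock.switch-U pm F-U r s))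
         (Membershipₚ.∈-allFin i)

  avoiding-bound : length avoiding * (k * k) ≤ length containing * k
  avoiding-bound = subst₂ _≤_
    (trans (length-cartesianProduct avoiding _)
      (cong (length avoiding *_)
        (trans (length-cartesianProduct (allFin k) (allFin k)) (cong₂ _*_ (length-allFin k) (length-allFin k)))))
    (trans (length-cartesianProduct containing _) (cong (length containing *_) (length-allFin k)))
    (injection⇒length≤ Triples Pairs switchWithBlock triples-unique switchWithBlock-injective switchWithBlock-∈)

  avoiding<containing : 2 ≤ k → length avoiding < length containing
  avoiding<containing 2≤k = n*k≤m⇒n<m 2≤k (Any⇒nonempty (onFin-∈-containing matchUW-isPerfectMatching refl))
    (*-cancelʳ-≤ (length avoiding * k) (length containing) k {{>-nonZero (<-trans (s≤s z≤n) 2≤k)}}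
      (subst (_≤ length containing * k) (sym (*-assoc (length avoiding) k k)) avoiding-bound))

  pGtHalf-UW : 2 ≤ k → pGtHalf graph u₀ v₀
  pGtHalf-UW 2≤k = begin-strict
    #PM graph                             ≡⟨ sym (length-filterᵇ-not containsUW (perfectMatchings graph)) ⟩
    length containing + length avoiding   <⟨ +-monoʳ-< (length containing) (avoiding<containing 2≤k) ⟩
    length containing + length containing ≡⟨ cong (length containing +_) (sym (+-identityʳ _)) ⟩
    2 * length containing                 ∎
    where open ≤-Reasoning

lemma5p3 : (d : ℕ) → 3 ≤ d →
    Σ ℕ λ n → Σ (SimpleGraph n) λ G →
      IsRegular d G × IsBipartite G ×
      Σ (Fin n) λ u → Σ (Fin n) λ v → adj G u v ≡ true × pGtHalf G u v
lemma5p3 _ (s≤s (s≤s (s≤s (z≤n {n = m})))) =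
  N , graph , graph-regular , graph-bipartite side neighbours-bipartite ,
  u₀ , v₀ , graph-adj {U} {W} (here refl) , pGtHalf-UW (s≤s (s≤s z≤n))
  where open Gadget (suc (suc m))
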